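{- Let $r_1\mid r_2\mid\cdots\mid r_n$ be positive integers, $G=\mathbb{Z}/r_1\mathbb{Z}\times\cdots\times\mathbb{Z}/r_n\mathbb{Z}$, $p$ a prime dividing $r_n$, and $\vec\beta$ an integer vector with $0\le\beta_j\le r_j-1$. Then $|A_{\vec\beta,p}|=p^{v_p(|G|)-v_p(e(\vec\beta))}$.
   Context: $v_p$ is the $p$-adic valuation. Let $\mathcal R^\dagger_p=\{1,\dots,p^{v_p(r_1)}\}\times\cdots\times\{1,\dots,p^{v_p(r_n)}\}$ and $A_{\vec\beta,p}=\{\vec\omega\in\mathcal R^\dagger_p:\sum_{j=1}^np^{v_p(r_n)-v_p(r_j)}\omega_j\beta_j\equiv0\pmod{p^{v_p(r_n)}}\}$. $e(\vec\beta)=\operatorname{lcm}_{j}\frac{r_j}{\gcd(r_j,\beta_j)}$ with $\gcd(r_j,0)=r_j$. -}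

module Defs where

open import Data.Nat using (ℕ; zero; suc; _+_; _*_; _∸_; _^_; _/_; _%_)
open import Data.Nat.Divisibility using (_∣?_)
open import Data.Nat.GCD using (gcd)
open import Data.Nat.LCM using (lcm)
open import Data.Bool using (Bool; true; false; if_then_else_)
open import Data.Fin using (Fin)
open import Data.Vec using (Vec; []; _∷_; foldr; map; zipWith; last)
open import Data.List as List using (List; upTo; length; filter; concatMap)
open import Relation.Nullary.Decidable using (⌊_⌋)
open import Data.Nat.Properties using (_≟_)

_÷_ : ℕ → ℕ → ℕ
m ÷ zero = zero
m ÷ suc k = m / suc k

-- p-adic valuation v_p(x) for x ≥ 1 and p ≥ 2 : the largest k with p^k ∣ x.
-- Computed with fuel (x itself suffices). Conventions v_p(0) = 0 and
-- v_p(x) = 0 for p ≤ 1 are irrelevant for the statement (only used for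
-- positive arguments and prime p).
valAux : ℕ → ℕ → ℕ → ℕ
valAux zero p x = zero
valAux (suc fuel) zero x = zero
valAux (suc fuel) (suc zero) x = zero
valAux (suc fuel) p@(suc (suc _)) zero = zero
valAux (suc fuel) p@(suc (suc _)) x@(suc _) =
  if ⌊ p ∣? x ⌋ then suc (valAux fuel p (x / p)) else zero

v : ℕ → ℕ → ℕ
v p x = valAux x p x

orderG : ∀ {n} → Vec ℕ n → ℕ
orderG r = foldr _ _*_ 1 r

-- e(β) = lcm_j r_j / gcd(r_j, β_j)   (stdlib: gcd r 0 = r)
e : ∀ {n} → Vec ℕ n → Vec ℕ n → ℕ
e r β = foldr _ lcm 1 (zipWith (λ rj βj → rj ÷ gcd rj βj) r β)

boxes : ∀ {n} → Vec ℕ n → List (Vec ℕ n)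
boxes [] = [] List.∷ List.[]
boxes (N ∷ Ns) =
  concatMap (λ w → List.map (w ∷_) (boxes Ns)) (List.map suc (upTo N))

weightedSum : ∀ {n} → Vec ℕ n → Vec ℕ n → Vec ℕ n → ℕ
weightedSum [] [] [] = 0
weightedSum (c ∷ cs) (w ∷ ws) (b ∷ bs) = c * w * b + weightedSum cs ws bs

-- A_{β,p} with r = (r_1,…,r_{m+1}) (so r_n = last r)
A : ∀ {m} → ℕ → Vec ℕ (suc m) → Vec ℕ (suc m) → List (Vec ℕ (suc m))
A p r β =
  let vn = v p (last r)
      vs = map (v p) r
      cs = map (λ vj → p ^ (vn ∸ vj)) vs
  in filter (λ ω → p ^ vn ∣? weightedSum cs ω β) (boxes (map (p ^_) vs))

-- Write a_j = v_p(r_j), K = v_p(r_n) and ε_j = v_p(r_j / gcd(r_j, β_j)). Then a_j ≤ K because r_j ∣ r_n,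
-- and p^ε_j is the additive order of p^(K − a_j) β_j modulo p^K. Fix a shift t and count the ω in the box
-- ∏_j [1, p^a_j] with p^K ∣ t + Σ_j p^(K − a_j) ω_j β_j, one coordinate at a time: the count is p^n if
-- p^(K − E) ∣ t and 0 otherwise, where E = max_j ε_j and n + E = Σ_j a_j. Adding a coordinate whose
-- coefficient has order p^ε turns the condition on its entry into a linear congruence modulo p^(ε ∸ E)
-- with a unit coefficient, which has exactly one solution per period of [1, p^a]. As v_p is additive on
-- products and takes maxima on lcms, Σ_j a_j = v_p(|G|) and E = v_p(e(β)); take t = 0.

module Submission where

open import Defs
open import Data.Nat using (ℕ; suc; _<_; _∸_; _^_; _≤_)
open import Data.Nat.Divisibility using (_∣_)
open import Data.Nat.Primality using (Prime)
open import Data.Fin using (Fin; inject₁) renaming (suc to fsuc)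
open import Data.Vec using (Vec; lookup; last)
open import Data.List using (length)
open import Relation.Binary.PropositionalEquality using (_≡_)

open import Data.Fin using () renaming (zero to fzero)
open import Data.List using (List; []; _∷_; _++_; [_]; filter; upTo; applyUpTo; concatMap) renaming (map to mapₗ)
open import Data.List.Properties using (length-++; filter-++; filter-≐; map-upTo)
open import Data.Nat as ℕ using (zero; _+_; _*_; _⊔_; NonZero; z≤n; s≤s; z<s; >-nonZero; >-nonZero⁻¹; nonTrivial⇒n>1; ≢-nonZero; ≢-nonZero⁻¹)
open import Data.Nat.Coprimality using (Coprime; coprime-Bézout; coprime-divisor; coprime-/gcd; 1-coprimeTo)
open import Data.Nat.DivMod using (_/_; _%_; m≡m%n+[m/n]*n; m%n<n; m*n/n≡m; m/n*n≡m)
open import Data.Nat.Divisibility using (_∤_; _∣?_; divides; divides-refl; ∣-refl; ∣-trans; ∣m∣n⇒∣m+n; ∣m+n∣m⇒∣n;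
    m∣m*n; n∣m*n; ∣n⇒∣m*n; *-monoʳ-∣; *-pres-∣; *-cancelˡ-∣; >⇒∤; 1∣_; _∣0; ∣1⇒≡1)
open import Data.Nat.GCD using (gcd; gcd[m,n]∣m; gcd[m,n]∣n; gcd[m,n]≢0; m/gcd[m,n]≢0; module Bézout)
open import Data.Nat.LCM using (lcm; lcm-least; m∣lcm[m,n]; n∣lcm[m,n]; gcd*lcm)
open import Data.Nat.Primality using (prime⇒nonZero; prime⇒nonTrivial; prime⇒irreducible; euclidsLemma)
open import Data.Nat.Properties
open import Data.Nat.Tactic.RingSolver using (solve-∀)
open import Data.Product using (∃-syntax; _×_; _,_; proj₁; proj₂)
open import Data.Sum using (inj₁; inj₂; [_,_]′)
open import Data.Vec using ([]; _∷_; map; sum; foldr; zipWith)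
open import Data.Vec.Properties using (lookup-map; lookup-zipWith)
open import Function using (_∘_)
open import Level using (Level)
open import Relation.Binary.PropositionalEquality using (refl; sym; trans; cong; cong₂; subst; subst₂; module ≡-Reasoning)
open import Relation.Nullary using (¬_; yes; no; contradiction)
open import Relation.Unary using (Pred; Decidable; _⊆_; _≐_)

private
  variable
    ℓ : Level
    X Y : Set

-- Counting in lists

count : {P : Pred X ℓ} → Decidable P → List X → ℕ
count P? xs = length (filter P? xs)

module _ {P : Pred Y ℓ} (P? : Decidable P) where

  count-++ : ∀ xs ys → count P? (xs ++ ys) ≡ count P? xs + count P? ys
  count-++ xs ys = trans (cong length (filter-++ P? xs ys)) (length-++ (filter P? xs))

  count-map : (f : X → Y) → ∀ xs → count P? (mapₗ f xs) ≡ count (P? ∘ f) xs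
  count-map f [] = refl
  count-map f (x ∷ xs) with P? (f x)
  ... | yes _ = cong suc (count-map f xs)
  ... | no _ = count-map f xs

  count-≐ : {Q : Pred Y ℓ} (Q? : Decidable Q) → P ≐ Q → ∀ xs → count P? xs ≡ count Q? xs
  count-≐ Q? P≐Q xs = cong length (filter-≐ P? Q? P≐Q xs)

  count-concatMap : {Q : Pred X ℓ} (Q? : Decidable Q) (f : X → List Y) {c : ℕ} →
    (∀ {x} → Q x → count P? (f x) ≡ c) → (∀ {x} → ¬ Q x → count P? (f x) ≡ 0) →
    ∀ xs → count P? (concatMap f xs) ≡ c * count Q? xs
  count-concatMap Q? f {c} on off [] = sym (*-zeroʳ c)
  count-concatMap Q? f {c} on off (x ∷ xs) with Q? x
  ... | yes q = begin
    count P? (f x ++ concatMap f xs)            ≡⟨ count-++ (f x) (concatMap f xs) ⟩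
    count P? (f x) + count P? (concatMap f xs)  ≡⟨ cong₂ _+_ (on q) (count-concatMap Q? f on off xs) ⟩
    c + c * count Q? xs                         ≡⟨ *-suc c _ ⟨
    c * suc (count Q? xs)                       ∎
    where open ≡-Reasoning
  ... | no q = trans (count-++ (f x) (concatMap f xs)) (cong₂ _+_ (off q) (count-concatMap Q? f on off xs))

interval : ℕ → ℕ → List ℕ
interval s zero = []
interval s (suc n) = s ∷ interval (suc s) n

interval-++ : ∀ s m n → interval s (m + n) ≡ interval s m ++ interval (s + m) n
interval-++ s zero n = cong (λ s′ → interval s′ n) (sym (+-identityʳ s))
interval-++ s (suc m) n = cong (s ∷_) (trans (interval-++ (suc s) m n) (cong (λ s′ → interval (suc s) m ++ interval s′ n) (sym (+-suc s m))))

map-suc-interval : ∀ s n → mapₗ suc (interval s n) ≡ interval (suc s) n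
map-suc-interval s zero = refl
map-suc-interval s (suc n) = cong (suc s ∷_) (map-suc-interval (suc s) n)

upTo-interval : ∀ n → upTo n ≡ interval 0 n
upTo-interval zero = refl
upTo-interval (suc n) = cong (0 ∷_) (begin
  applyUpTo suc n          ≡⟨ map-upTo suc n ⟨
  mapₗ suc (upTo n)        ≡⟨ cong (mapₗ suc) (upTo-interval n) ⟩
  mapₗ suc (interval 0 n)  ≡⟨ map-suc-interval 0 n ⟩
  interval 1 n             ∎)
  where open ≡-Reasoning

map-suc-upTo : ∀ n → mapₗ suc (upTo n) ≡ interval 1 n
map-suc-upTo n = trans (cong (mapₗ suc) (upTo-interval n)) (map-suc-interval 0 n)

module _ {P : Pred ℕ ℓ} (P? : Decidable P) where

  count-interval-none : ∀ s n → (∀ {y} → s ≤ y → y < s + n → ¬ P y) → count P? (interval s n) ≡ 0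
  count-interval-none s zero none = refl
  count-interval-none s (suc n) none with P? s
  ... | yes Ps = contradiction Ps (none ≤-refl (m<m+n s z<s))
  ... | no _ = count-interval-none (suc s) n (λ {y} s<y y< → none (<⇒≤ s<y) (subst (y <_) (sym (+-suc s n)) y<))

  count-interval-unique : ∀ s n {x} → s ≤ x → x < s + n → P x →
    (∀ {y} → s ≤ y → y < s + n → P y → y ≡ x) → count P? (interval s n) ≡ 1
  count-interval-unique s zero s≤x x< _ _ = contradiction (subst (_ <_) (+-identityʳ s) x<) (≤⇒≯ s≤x)
  count-interval-unique s (suc n) {x} s≤x x< Px unique with P? s
  ... | yes Ps = cong suc (count-interval-none (suc s) n (λ {y} s<y y< Py →
        <⇒≢ s<y (trans (unique ≤-refl (m<m+n s z<s) Ps) (sym (unique (<⇒≤ s<y) (subst (y <_) (sym (+-suc s n)) y<) Py)))))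
  ... | no ¬Ps = count-interval-unique (suc s) n s<x (subst (x <_) (+-suc s n) x<) Px
        (λ {y} s<y y< → unique (<⇒≤ s<y) (subst (y <_) (sym (+-suc s n)) y<))
    where
    s<x : s < x
    s<x = ≤∧≢⇒< s≤x (λ s≡x → ¬Ps (subst P (sym s≡x) Px))

  module _ {M : ℕ} (periodic : P ≐ (λ w → P (w + M))) where

    count-singleton-periodic : ∀ w → count P? [ w ] ≡ count P? [ w + M ]
    count-singleton-periodic w with P? w | P? (w + M)
    ... | yes _ | yes _ = refl
    ... | no _ | no _ = refl
    ... | yes Pw | no ¬Pw+M = contradiction (proj₁ periodic Pw) ¬Pw+M
    ... | no ¬Pw | yes Pw+M = contradiction (proj₂ periodic Pw+M) ¬Pw

    -- Sliding the window one step drops s and adds s + M, on which P agrees.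
    count-interval-slide : ∀ s → count P? (interval s M) ≡ count P? (interval 0 M)
    count-interval-slide zero = refl
    count-interval-slide (suc s) = +-cancelˡ-≡ (count P? [ s ]) _ _ (begin
      count P? [ s ] + count P? (interval (suc s) M)  ≡⟨ count-++ P? [ s ] (interval (suc s) M) ⟨
      count P? (interval s (1 + M))                    ≡⟨ cong (count P? ∘ interval s) (+-comm 1 M) ⟩
      count P? (interval s (M + 1))                    ≡⟨ cong (count P?) (interval-++ s M 1) ⟩
      count P? (interval s M ++ [ s + M ])             ≡⟨ count-++ P? (interval s M) [ s + M ] ⟩
      count P? (interval s M) + count P? [ s + M ]     ≡⟨ cong₂ _+_ (count-interval-slide s) (sym (count-singleton-periodic s)) ⟩
      count P? (interval 0 M) + count P? [ s ]         ≡⟨ +-comm (count P? (interval 0 M)) _ ⟩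
      count P? [ s ] + count P? (interval 0 M)         ∎)
      where open ≡-Reasoning

    count-interval-periods : ∀ s q → count P? (interval s (q * M)) ≡ q * count P? (interval 0 M)
    count-interval-periods s zero = refl
    count-interval-periods s (suc q) = begin
      count P? (interval s (M + q * M))                              ≡⟨ cong (count P?) (interval-++ s M (q * M)) ⟩
      count P? (interval s M ++ interval (s + M) (q * M))            ≡⟨ count-++ P? (interval s M) _ ⟩
      count P? (interval s M) + count P? (interval (s + M) (q * M))  ≡⟨ cong₂ _+_ (count-interval-slide s) (count-interval-periods (s + M) q) ⟩
      count P? (interval 0 M) + q * count P? (interval 0 M)          ∎
      where open ≡-Reasoning

-- Linear congruences

module LinearCongruence {M u : ℕ} .{{_ : NonZero M}} (M⊥u : Coprime M u) (t : ℕ) where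

  Solves : ℕ → Set
  Solves w = M ∣ t + w * u

  solves? : Decidable Solves
  solves? w = M ∣? t + w * u

  solves-periodic : ∀ k → Solves ≐ (λ w → Solves (w + k * M))
  solves-periodic k = (λ {w} h → subst (M ∣_) (sym (shift t w k M u)) (∣m∣n⇒∣m+n h (m∣m*n (k * u))))
                    , (λ {w} h → ∣m+n∣m⇒∣n (subst (M ∣_) (trans (shift t w k M u) (+-comm (t + w * u) _)) h) (m∣m*n (k * u)))
    where
    shift : ∀ t w k M u → t + (w + k * M) * u ≡ (t + w * u) + M * (k * u)
    shift = solve-∀

  solves-period : Solves ≐ (λ w → Solves (w + M))
  solves-period = subst (λ m → Solves ≐ (λ w → Solves (w + m))) (*-identityˡ M) (solves-periodic 1)

  solution-gap : ∀ x d → d < M → Solves x → Solves (x + d) → d ≡ 0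
  solution-gap x zero _ _ _ = refl
  solution-gap x (suc d) d<M Sx Sx+d = contradiction M∣d (>⇒∤ d<M)
    where
    gap : ∀ t x d u → t + (x + d) * u ≡ (t + x * u) + u * d
    gap = solve-∀
    M∣d : M ∣ suc d
    M∣d = coprime-divisor M⊥u (∣m+n∣m⇒∣n (subst (M ∣_) (gap t x (suc d) u) Sx+d) Sx)

  solution-≤-unique : ∀ {x y} → x ≤ y → y < M → Solves x → Solves y → x ≡ y
  solution-≤-unique {x} {y} x≤y y<M Sx Sy = begin
    x            ≡⟨ +-identityʳ x ⟨
    x + 0        ≡⟨ cong (x +_) gap≡0 ⟨
    x + (y ∸ x)  ≡⟨ m+[n∸m]≡n x≤y ⟩
    y            ∎
    where
    open ≡-Reasoning
    gap≡0 : y ∸ x ≡ 0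
    gap≡0 = solution-gap x (y ∸ x) (≤-<-trans (m∸n≤m y x) y<M) Sx (subst Solves (sym (m+[n∸m]≡n x≤y)) Sy)

  solution-unique : ∀ {x y} → x < M → y < M → Solves x → Solves y → y ≡ x
  solution-unique {x} {y} x<M y<M Sx Sy with ≤-total x y
  ... | inj₁ x≤y = sym (solution-≤-unique x≤y y<M Sx Sy)
  ... | inj₂ y≤x = solution-≤-unique y≤x x<M Sy Sx

  -- Bézout gives y with y u ≡ ∓ 1 (mod M); then w = t y, resp. w = (M ∸ 1) t y, solves.
  solution-exists : ∃[ w ] Solves w
  solution-exists with coprime-Bézout M⊥u
  ... | Bézout.+- x y eq = t * y , divides (t * x) (begin
    t + t * y * u    ≡⟨ factor t y u ⟩
    t * (1 + y * u)  ≡⟨ cong (t *_) eq ⟩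
    t * (x * M)      ≡⟨ *-assoc t x M ⟨
    t * x * M        ∎)
    where
    open ≡-Reasoning
    factor : ∀ t y u → t + t * y * u ≡ t * (1 + y * u)
    factor = solve-∀
  ... | Bézout.-+ x y eq = M′ * t * y , divides (t + M′ * t * x) (begin
    t + M′ * t * y * u               ≡⟨ reassoc t M′ y u ⟩
    t + M′ * t * (y * u)             ≡⟨ cong (λ z → t + M′ * t * z) eq ⟨
    t + M′ * t * (1 + x * M)         ≡⟨ expand t M′ x M ⟩
    suc M′ * t + M′ * t * x * M      ≡⟨ cong (λ z → z * t + M′ * t * x * M) (suc-pred M) ⟩
    M * t + M′ * t * x * M           ≡⟨ collect t M′ x M ⟩
    (t + M′ * t * x) * M             ∎)
    where
    open ≡-Reasoning
    M′ = ℕ.pred M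
    reassoc : ∀ t m y u → t + m * t * y * u ≡ t + m * t * (y * u)
    reassoc = solve-∀
    expand : ∀ t m x M → t + m * t * (1 + x * M) ≡ suc m * t + m * t * x * M
    expand = solve-∀
    collect : ∀ t m x M → M * t + m * t * x * M ≡ (t + m * t * x) * M
    collect = solve-∀

  count-solutions : ∀ s q → count solves? (interval s (q * M)) ≡ q
  count-solutions s q = begin
    count solves? (interval s (q * M))  ≡⟨ count-interval-periods solves? solves-period s q ⟩
    q * count solves? (interval 0 M)    ≡⟨ cong (q *_) one-per-period ⟩
    q * 1                               ≡⟨ *-identityʳ q ⟩
    q                                   ∎
    where
    open ≡-Reasoning
    w = proj₁ solution-exists
    w% = w % M
    Sw% : Solves w%
    Sw% = proj₂ (solves-periodic (w / M)) {w%} (subst Solves (m≡m%n+[m/n]*n w M) (proj₂ solution-exists))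
    one-per-period : count solves? (interval 0 M) ≡ 1
    one-per-period = count-interval-unique solves? 0 M z≤n (m%n<n w M) Sw%
                       (λ _ y<M Sy → solution-unique (m%n<n w M) y<M Sw% Sy)

record DivIndicator (K n : ℕ) (f : ℕ → ℕ) : Set where
  field
    on-multiples  : ∀ {t} → K ∣ t → f t ≡ n
    off-multiples : ∀ {t} → K ∤ t → f t ≡ 0

DivIndicator-cong : ∀ {K n f g} → (∀ t → f t ≡ g t) → DivIndicator K n f → DivIndicator K n g
DivIndicator-cong f≗g ind = record
  { on-multiples  = λ K∣t → trans (sym (f≗g _)) (on-multiples K∣t)
  ; off-multiples = λ K∤t → trans (sym (f≗g _)) (off-multiples K∤t)
  }
  where open DivIndicator ind

DivIndicator-scale : ∀ {K n f g} m → (∀ t → g t ≡ m * f t) → DivIndicator K n f → DivIndicator K (m * n) g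
DivIndicator-scale m g≡ ind = record
  { on-multiples  = λ K∣t → trans (g≡ _) (cong (m *_) (on-multiples K∣t))
  ; off-multiples = λ K∤t → trans (g≡ _) (trans (cong (m *_) (off-multiples K∤t)) (*-zeroʳ m))
  }
  where open DivIndicator ind

count-scaled-solutions : ∀ {N M u} .{{_ : NonZero N}} .{{_ : NonZero M}} → Coprime M u → ∀ s q →
  DivIndicator N q (λ t → count (λ w → N * M ∣? t + w * (N * u)) (interval s (q * M)))
count-scaled-solutions {N} {M} {u} M⊥u s q = record { on-multiples = on ; off-multiples = off }
  where
  factor : ∀ t w N u → t * N + w * (N * u) ≡ N * (t + w * u)
  factor = solve-∀

  on : ∀ {t} → N ∣ t → count (λ w → N * M ∣? t + w * (N * u)) (interval s (q * M)) ≡ q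
  on (divides-refl t) = trans (count-≐ _ (solves? t) ((λ {w} → cancel {w}) , (λ {w} → uncancel {w})) (interval s (q * M))) (count-solutions t s q)
    where
    open LinearCongruence M⊥u
    cancel : (λ w → N * M ∣ t * N + w * (N * u)) ⊆ Solves t
    cancel {w} h = *-cancelˡ-∣ N (subst (N * M ∣_) (factor t w N u) h)
    uncancel : Solves t ⊆ (λ w → N * M ∣ t * N + w * (N * u))
    uncancel {w} h = subst (N * M ∣_) (sym (factor t w N u)) (*-monoʳ-∣ N h)

  off : ∀ {t} → N ∤ t → count (λ w → N * M ∣? t + w * (N * u)) (interval s (q * M)) ≡ 0
  off {t} N∤t = count-interval-none _ s (q * M) λ {w} _ _ h →
    N∤t (∣m+n∣m⇒∣n (subst (N ∣_) (+-comm t _) (∣-trans (m∣m*n M) h)) (∣n⇒∣m*n w (m∣m*n u)))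

-- p-adic valuation

^-monoʳ-∣ : ∀ m {a b} → a ≤ b → m ^ a ∣ m ^ b
^-monoʳ-∣ m {a} {b} a≤b = divides (m ^ (b ∸ a)) (begin
  m ^ b                ≡⟨ cong (m ^_) (m∸n+n≡m a≤b) ⟨
  m ^ (b ∸ a + a)      ≡⟨ ^-distribˡ-+-* m (b ∸ a) a ⟩
  m ^ (b ∸ a) * m ^ a  ∎)
  where open ≡-Reasoning

exact-power-step : ∀ {P q x j} .{{_ : NonZero P}} → x ≡ q * P → P ^ j ∣ q × P ^ suc j ∤ q → P ^ suc j ∣ x × P ^ suc (suc j) ∤ x
exact-power-step {P} {q} {x} {j} x≡qP (Pʲ∣q , Pʲ⁺¹∤q) = ∣x , ∤x
  where
  x≡Pq : x ≡ P * q
  x≡Pq = trans x≡qP (*-comm q P)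
  ∣x : P ^ suc j ∣ x
  ∣x = subst (P ^ suc j ∣_) (sym x≡Pq) (*-monoʳ-∣ P Pʲ∣q)
  ∤x : P ^ suc (suc j) ∤ x
  ∤x h = Pʲ⁺¹∤q (*-cancelˡ-∣ P (subst (P ^ suc (suc j) ∣_) x≡Pq h))

valAux-spec : ∀ k fuel x .{{_ : NonZero x}} → x ≤ fuel →
  let P = 2 + k in P ^ valAux fuel P x ∣ x × P ^ suc (valAux fuel P x) ∤ x
valAux-spec k zero x x≤0 = contradiction x≤0 (<⇒≱ (>-nonZero⁻¹ x))
valAux-spec k (suc fuel) (suc x) x≤fuel with 2 + k ∣? suc x
... | no P∤x = 1∣ _ , λ h → P∤x (subst (_∣ suc x) (*-identityʳ (2 + k)) h)
... | yes (divides q x≡qP) =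
  subst (λ y → P ^ suc (valAux fuel P y) ∣ suc x × P ^ suc (suc (valAux fuel P y)) ∤ suc x)
        (sym (trans (cong (_/ P) x≡qP) (m*n/n≡m q P)))
        (exact-power-step {j = valAux fuel P q} x≡qP (valAux-spec k fuel q {{q≢0}} (≤-pred (≤-trans q<x x≤fuel))))
  where
  P = 2 + k
  q≢0 : NonZero q
  q≢0 = m*n≢0⇒m≢0 q {{subst NonZero x≡qP _}}
  q<x : q < suc x
  q<x = subst (q <_) (sym x≡qP) (m<m*n q P {{q≢0}} (s≤s (s≤s z≤n)))

maximum : ∀ {k} → Vec ℕ k → ℕ
maximum = foldr _ _⊔_ 0

lcm-nonZero : ∀ x y .{{_ : NonZero x}} .{{_ : NonZero y}} → NonZero (lcm x y)
lcm-nonZero x y = ≢-nonZero λ lcm≡0 → ≢-nonZero⁻¹ (x * y) {{m*n≢0 x y}}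
  (trans (sym (gcd*lcm x y)) (trans (cong (gcd x y *_) lcm≡0) (*-zeroʳ (gcd x y))))

orderG-nonZero : ∀ {k} (r : Vec ℕ k) → (∀ i → NonZero (lookup r i)) → NonZero (orderG r)
orderG-nonZero [] _ = _
orderG-nonZero (x ∷ r) r≢0 = m*n≢0 x (orderG r) {{r≢0 fzero}} {{orderG-nonZero r (r≢0 ∘ fsuc)}}

foldr-lcm-nonZero : ∀ {k} (xs : Vec ℕ k) → (∀ i → NonZero (lookup xs i)) → NonZero (foldr _ lcm 1 xs)
foldr-lcm-nonZero [] _ = _
foldr-lcm-nonZero (x ∷ xs) xs≢0 = lcm-nonZero x (foldr _ lcm 1 xs) {{xs≢0 fzero}} {{foldr-lcm-nonZero xs (xs≢0 ∘ fsuc)}}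

v-spec-≥2 : ∀ {p} → 2 ≤ p → ∀ x .{{_ : NonZero x}} → p ^ v p x ∣ x × p ^ suc (v p x) ∤ x
v-spec-≥2 {suc (suc k)} _ x = valAux-spec k x x ≤-refl
v-spec-≥2 {suc zero} (s≤s ()) x

module Valuation {p : ℕ} (p-prime : Prime p) where

  instance
    p≢0 : NonZero p
    p≢0 = prime⇒nonZero p-prime

  v-spec : ∀ x .{{_ : NonZero x}} → p ^ v p x ∣ x × p ^ suc (v p x) ∤ x
  v-spec = v-spec-≥2 (nonTrivial⇒n>1 p {{prime⇒nonTrivial p-prime}})

  ≤-v : ∀ {x k} .{{_ : NonZero x}} → p ^ k ∣ x → k ≤ v p x
  ≤-v {x} {k} pᵏ∣x with k ≤? v p x
  ... | yes k≤v = k≤v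
  ... | no k≰v = contradiction (∣-trans (^-monoʳ-∣ p (≰⇒> k≰v)) pᵏ∣x) (proj₂ (v-spec x))

  v-unique : ∀ {x k} .{{_ : NonZero x}} → p ^ k ∣ x → p ^ suc k ∤ x → v p x ≡ k
  v-unique {x} {k} pᵏ∣x pᵏ⁺¹∤x = ≤-antisym (≮⇒≥ λ k<v → pᵏ⁺¹∤x (∣-trans (^-monoʳ-∣ p k<v) (proj₁ (v-spec x)))) (≤-v pᵏ∣x)

  ^-suc-∣⇒∣ : ∀ k {c} → p ^ suc k ∣ p ^ k * c → p ∣ c
  ^-suc-∣⇒∣ k {c} h = *-cancelˡ-∣ (p ^ k) {{m^n≢0 p k}} (subst (_∣ p ^ k * c) (*-comm p (p ^ k)) h)

  v-≡ : ∀ {x k c} .{{_ : NonZero x}} → x ≡ p ^ k * c → p ∤ c → v p x ≡ k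
  v-≡ {k = k} {c} x≡ p∤c = v-unique (divides c (trans x≡ (*-comm _ c))) (λ h → p∤c (^-suc-∣⇒∣ k (subst (_ ∣_) x≡ h)))

  v-cofactor : ∀ x .{{_ : NonZero x}} → ∃[ y ] x ≡ p ^ v p x * y × p ∤ y
  v-cofactor x with v-spec x
  ... | divides y x≡ypᵛ , pᵛ⁺¹∤x = y , x≡pᵛy , λ p∣y →
        pᵛ⁺¹∤x (subst₂ _∣_ (*-comm (p ^ v p x) p) (sym x≡pᵛy) (*-monoʳ-∣ (p ^ v p x) p∣y))
    where
    x≡pᵛy : x ≡ p ^ v p x * y
    x≡pᵛy = trans x≡ypᵛ (*-comm y _)

  v-1 : v p 1 ≡ 0
  v-1 = v-≡ (sym (*-identityʳ 1)) λ p∣1 → <⇒≢ (nonTrivial⇒n>1 p {{prime⇒nonTrivial p-prime}}) (sym (∣1⇒≡1 p∣1))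

  v-mono-∣ : ∀ {x y} .{{_ : NonZero x}} .{{_ : NonZero y}} → x ∣ y → v p x ≤ v p y
  v-mono-∣ {x} x∣y = ≤-v (∣-trans (proj₁ (v-spec x)) x∣y)

  v-* : ∀ x y .{{_ : NonZero x}} .{{_ : NonZero y}} → v p (x * y) ≡ v p x + v p y
  v-* x y with v-cofactor x | v-cofactor y
  ... | x′ , x≡ , p∤x′ | y′ , y≡ , p∤y′ = v-≡ {{m*n≢0 x y}} xy≡ λ p∣x′y′ → [ p∤x′ , p∤y′ ]′ (euclidsLemma x′ y′ p-prime p∣x′y′)
    where
    open ≡-Reasoning
    regroup : ∀ A B x y → (A * x) * (B * y) ≡ (A * B) * (x * y)
    regroup = solve-∀
    xy≡ : x * y ≡ p ^ (v p x + v p y) * (x′ * y′)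
    xy≡ = begin
      x * y                                  ≡⟨ cong₂ _*_ x≡ y≡ ⟩
      (p ^ v p x * x′) * (p ^ v p y * y′)    ≡⟨ regroup (p ^ v p x) (p ^ v p y) x′ y′ ⟩
      (p ^ v p x * p ^ v p y) * (x′ * y′)    ≡⟨ cong (_* (x′ * y′)) (^-distribˡ-+-* p (v p x) (v p y)) ⟨
      p ^ (v p x + v p y) * (x′ * y′)        ∎

  v-lcm : ∀ x y .{{_ : NonZero x}} .{{_ : NonZero y}} → v p (lcm x y) ≡ v p x ⊔ v p y
  v-lcm x y with v-cofactor x | v-cofactor y
  ... | x′ , x≡ , p∤x′ | y′ , y≡ , p∤y′ = v-unique {{lcm-nonZero x y}} pᴹ∣lcm λ h →
        [ p∤x′ , p∤y′ ]′ (euclidsLemma x′ y′ p-prime (^-suc-∣⇒∣ M (∣-trans h (lcm-least x∣ y∣))))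
    where
    M = v p x ⊔ v p y
    pᴹ∣lcm : p ^ M ∣ lcm x y
    pᴹ∣lcm with ≤-total (v p x) (v p y)
    ... | inj₁ a≤b = subst (λ k → p ^ k ∣ lcm x y) (sym (m≤n⇒m⊔n≡n a≤b)) (∣-trans (proj₁ (v-spec y)) (n∣lcm[m,n] x y))
    ... | inj₂ b≤a = subst (λ k → p ^ k ∣ lcm x y) (sym (m≥n⇒m⊔n≡m b≤a)) (∣-trans (proj₁ (v-spec x)) (m∣lcm[m,n] x y))
    x∣ : x ∣ p ^ M * (x′ * y′)
    x∣ = subst (_∣ p ^ M * (x′ * y′)) (sym x≡) (*-pres-∣ (^-monoʳ-∣ p (m≤m⊔n (v p x) (v p y))) (m∣m*n y′))
    y∣ : y ∣ p ^ M * (x′ * y′)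
    y∣ = subst (_∣ p ^ M * (x′ * y′)) (sym y≡) (*-pres-∣ (^-monoʳ-∣ p (m≤n⊔m (v p x) (v p y))) (n∣m*n x′))

  v-orderG : ∀ {k} (r : Vec ℕ k) → (∀ i → NonZero (lookup r i)) → v p (orderG r) ≡ sum (map (v p) r)
  v-orderG [] _ = v-1
  v-orderG (x ∷ r) r≢0 = trans (v-* x (orderG r) {{r≢0 fzero}} {{orderG-nonZero r (r≢0 ∘ fsuc)}})
                               (cong (v p x +_) (v-orderG r (r≢0 ∘ fsuc)))

  v-foldr-lcm : ∀ {k} (xs : Vec ℕ k) → (∀ i → NonZero (lookup xs i)) → v p (foldr _ lcm 1 xs) ≡ maximum (map (v p) xs)
  v-foldr-lcm [] _ = v-1
  v-foldr-lcm (x ∷ xs) xs≢0 = trans (v-lcm x (foldr _ lcm 1 xs) {{xs≢0 fzero}} {{foldr-lcm-nonZero xs (xs≢0 ∘ fsuc)}})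
                                    (cong (v p x ⊔_) (v-foldr-lcm xs (xs≢0 ∘ fsuc)))

-- Counting solutions in a box

coprime-*ˡ : ∀ {a b u} → Coprime a u → Coprime b u → Coprime (a * b) u
coprime-*ˡ {a} a⊥u b⊥u (d∣ab , d∣u) = b⊥u (coprime-divisor d⊥a d∣ab , d∣u)
  where
  d⊥a : Coprime _ a
  d⊥a (e∣d , e∣a) = a⊥u (e∣a , ∣-trans e∣d d∣u)

prime-∤⇒coprime : ∀ {p u} → Prime p → p ∤ u → Coprime p u
prime-∤⇒coprime p-prime p∤u (d∣p , d∣u) with prime⇒irreducible p-prime d∣p
... | inj₁ d≡1 = d≡1
... | inj₂ refl = contradiction d∣u p∤u

prime^-∤⇒coprime : ∀ {p u} → Prime p → p ∤ u → ∀ k → Coprime (p ^ k) u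
prime^-∤⇒coprime p-prime p∤u zero = 1-coprimeTo _
prime^-∤⇒coprime p-prime p∤u (suc k) = coprime-*ˡ (prime-∤⇒coprime p-prime p∤u) (prime^-∤⇒coprime p-prime p∤u k)

m⊔n≡n+[m∸n] : ∀ m n → m ⊔ n ≡ n + (m ∸ n)
m⊔n≡n+[m∸n] m n with ≤-total m n
... | inj₁ m≤n = trans (m≤n⇒m⊔n≡n m≤n) (sym (trans (cong (n +_) (m≤n⇒m∸n≡0 m≤n)) (+-identityʳ n)))
... | inj₂ n≤m = trans (m≥n⇒m⊔n≡m n≤m) (sym (m+[n∸m]≡n n≤m))

∸⊔+∸≡∸ : ∀ {k m} n → m ≤ k → k ∸ (m ⊔ n) + (m ∸ n) ≡ k ∸ n
∸⊔+∸≡∸ {k} {m} n m≤k = begin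
  k ∸ (m ⊔ n) + (m ∸ n)          ≡⟨ cong (λ x → k ∸ x + (m ∸ n)) (m⊔n≡n+[m∸n] m n) ⟩
  k ∸ (n + (m ∸ n)) + (m ∸ n)    ≡⟨ cong (_+ (m ∸ n)) (∸-+-assoc k n (m ∸ n)) ⟨
  k ∸ n ∸ (m ∸ n) + (m ∸ n)      ≡⟨ m∸n+n≡m (∸-monoˡ-≤ n m≤k) ⟩
  k ∸ n                          ∎
  where open ≡-Reasoning

-- p ^ ε is the additive order of g modulo p ^ K.
record HasOrderMod (p K ε g : ℕ) : Set where
  field
    ε≤K           : ε ≤ K
    cofactor      : ℕ
    factorisation : g ≡ p ^ (K ∸ ε) * cofactor
    p∤cofactor    : 0 < ε → p ∤ cofactor

  -- Modulo p ^ (K ∸ E) the order drops to p ^ (ε ∸ E).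
  reduce : Prime p → ∀ E → ∃[ u ] g ≡ p ^ (K ∸ (ε ⊔ E)) * u × Coprime (p ^ (ε ∸ E)) u
  reduce p-prime E with ε ≤? E
  ... | no ε≰E = cofactor , subst (λ x → g ≡ p ^ (K ∸ x) * cofactor) (sym (m≥n⇒m⊔n≡m (<⇒≤ E<ε))) factorisation
                          , prime^-∤⇒coprime p-prime (p∤cofactor (≤-<-trans z≤n E<ε)) (ε ∸ E)
    where
    E<ε : E < ε
    E<ε = ≰⇒> ε≰E
  ... | yes ε≤E = u , g≡ , subst (λ k → Coprime (p ^ k) u) (sym (m≤n⇒m∸n≡0 ε≤E)) (1-coprimeTo u)
    where
    open ≡-Reasoning
    u = p ^ (K ∸ ε ∸ (K ∸ E)) * cofactor
    K∸E≤K∸ε : K ∸ E ≤ K ∸ ε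
    K∸E≤K∸ε = ∸-monoʳ-≤ K ε≤E
    g≡ : g ≡ p ^ (K ∸ (ε ⊔ E)) * u
    g≡ = begin
      g                                                   ≡⟨ factorisation ⟩
      p ^ (K ∸ ε) * cofactor                              ≡⟨ cong (λ x → p ^ x * cofactor) (m+[n∸m]≡n K∸E≤K∸ε) ⟨
      p ^ (K ∸ E + (K ∸ ε ∸ (K ∸ E))) * cofactor          ≡⟨ cong (_* cofactor) (^-distribˡ-+-* p (K ∸ E) _) ⟩
      p ^ (K ∸ E) * p ^ (K ∸ ε ∸ (K ∸ E)) * cofactor      ≡⟨ *-assoc (p ^ (K ∸ E)) _ cofactor ⟩
      p ^ (K ∸ E) * u                                     ≡⟨ cong (λ x → p ^ (K ∸ x) * u) (m≤n⇒m⊔n≡n ε≤E) ⟨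
      p ^ (K ∸ (ε ⊔ E)) * u                               ∎

module BoxCount {p : ℕ} (p-prime : Prime p) (K : ℕ) where

  instance
    p≢0 : NonZero p
    p≢0 = prime⇒nonZero p-prime

  count-coordinate : ∀ {a b c ε} → HasOrderMod p K ε (c * b) → ε ≤ a → ∀ E →
    DivIndicator (p ^ (K ∸ (ε ⊔ E))) (p ^ (a ∸ (ε ∸ E)))
                 (λ t → count (λ w → p ^ (K ∸ E) ∣? t + c * w * b) (interval 1 (p ^ a)))
  count-coordinate {a} {b} {c} {ε} order ε≤a E with HasOrderMod.reduce order p-prime E
  ... | u , cb≡ , M⊥u = DivIndicator-cong (λ _ → sym same-count)
                          (count-scaled-solutions {N} {M} {{m^n≢0 p (K ∸ (ε ⊔ E))}} {{m^n≢0 p (ε ∸ E)}} M⊥u 1 q)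
    where
    N = p ^ (K ∸ (ε ⊔ E))
    M = p ^ (ε ∸ E)
    q = p ^ (a ∸ (ε ∸ E))
    NM≡ : N * M ≡ p ^ (K ∸ E)
    NM≡ = trans (sym (^-distribˡ-+-* p (K ∸ (ε ⊔ E)) (ε ∸ E))) (cong (p ^_) (∸⊔+∸≡∸ E (HasOrderMod.ε≤K order)))
    qM≡ : q * M ≡ p ^ a
    qM≡ = trans (sym (^-distribˡ-+-* p (a ∸ (ε ∸ E)) (ε ∸ E))) (cong (p ^_) (m∸n+n≡m (≤-trans (m∸n≤m ε E) ε≤a)))
    cwb≡ : ∀ w → c * w * b ≡ w * (N * u)
    cwb≡ w = trans (reorder c w b) (cong (w *_) cb≡)
      where
      reorder : ∀ c w b → c * w * b ≡ w * (c * b)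
      reorder = solve-∀
    same-count : ∀ {t} → count (λ w → p ^ (K ∸ E) ∣? t + c * w * b) (interval 1 (p ^ a))
                       ≡ count (λ w → N * M ∣? t + w * (N * u)) (interval 1 (q * M))
    same-count {t} = trans (count-≐ _ _ ((λ {w} → subst₂ _∣_ (sym NM≡) (cong (t +_) (cwb≡ w)))
                                       , (λ {w} → subst₂ _∣_ NM≡ (cong (t +_) (sym (cwb≡ w)))))
                                     (interval 1 (p ^ a)))
                           (cong (count (λ w → N * M ∣? t + w * (N * u)) ∘ interval 1) (sym qM≡))

  count-box : ∀ {k} (as cs bs εs : Vec ℕ k) →
    (∀ i → lookup εs i ≤ lookup as i) →
    (∀ i → HasOrderMod p K (lookup εs i) (lookup cs i * lookup bs i)) →
    ∃[ n ] n + maximum εs ≡ sum as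
         × DivIndicator (p ^ (K ∸ maximum εs)) (p ^ n)
                        (λ t → count (λ ω → p ^ K ∣? t + weightedSum cs ω bs) (boxes (map (p ^_) as)))
  count-box [] [] [] [] _ _ = 0 , refl , record { on-multiples = on ; off-multiples = off }
    where
    on : ∀ {t} → p ^ K ∣ t → count (λ ω → p ^ K ∣? t + weightedSum [] ω []) ([] ∷ []) ≡ 1
    on {t} pᴷ∣t with p ^ K ∣? t + 0
    ... | yes _ = refl
    ... | no pᴷ∤t = contradiction (subst (p ^ K ∣_) (sym (+-identityʳ t)) pᴷ∣t) pᴷ∤t
    off : ∀ {t} → p ^ K ∤ t → count (λ ω → p ^ K ∣? t + weightedSum [] ω []) ([] ∷ []) ≡ 0
    off {t} pᴷ∤t with p ^ K ∣? t + 0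
    ... | yes pᴷ∣t = contradiction (subst (p ^ K ∣_) (+-identityʳ t) pᴷ∣t) pᴷ∤t
    ... | no _ = refl
  count-box (a ∷ as) (c ∷ cs) (b ∷ bs) (ε ∷ εs) ε≤a order
    with count-box as cs bs εs (ε≤a ∘ fsuc) (order ∘ fsuc)
  ... | n , n+E≡S , tail =
    n + j , exponent ,
    subst (λ x → DivIndicator _ x _) (sym (^-distribˡ-+-* p n j))
      (DivIndicator-scale (p ^ n) split (count-coordinate {a} {b} {c} (order fzero) (ε≤a fzero) E))
    where
    open ≡-Reasoning
    E = maximum εs
    j = a ∸ (ε ∸ E)
    B = boxes (map (p ^_) as)

    prefix : ∀ t w → count (λ ω → p ^ K ∣? t + weightedSum (c ∷ cs) ω (b ∷ bs)) (mapₗ (w ∷_) B)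
                   ≡ count (λ ω → p ^ K ∣? (t + c * w * b) + weightedSum cs ω bs) B
    prefix t w = trans (count-map _ (w ∷_) B)
      (count-≐ _ _ ((λ {ω} → subst (p ^ K ∣_) (sym (+-assoc t _ _))) , (λ {ω} → subst (p ^ K ∣_) (+-assoc t _ _))) B)

    split : ∀ t → count (λ ω → p ^ K ∣? t + weightedSum (c ∷ cs) ω (b ∷ bs)) (boxes (map (p ^_) (a ∷ as)))
                ≡ p ^ n * count (λ w → p ^ (K ∸ E) ∣? t + c * w * b) (interval 1 (p ^ a))
    split t = trans (count-concatMap _ (λ w → p ^ (K ∸ E) ∣? t + c * w * b) (λ w → mapₗ (w ∷_) B)
                       (λ {w} q → trans (prefix t w) (DivIndicator.on-multiples tail q))
                       (λ {w} q → trans (prefix t w) (DivIndicator.off-multiples tail q))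
                       (mapₗ suc (upTo (p ^ a))))
                    (cong (λ xs → p ^ n * count (λ w → p ^ (K ∸ E) ∣? t + c * w * b) xs) (map-suc-upTo (p ^ a)))

    exponent : n + j + (ε ⊔ E) ≡ a + sum as
    exponent = begin
      n + j + (ε ⊔ E)             ≡⟨ cong (n + j +_) (m⊔n≡n+[m∸n] ε E) ⟩
      n + j + (E + (ε ∸ E))       ≡⟨ regroup n j E (ε ∸ E) ⟩
      (j + (ε ∸ E)) + (n + E)     ≡⟨ cong₂ _+_ (m∸n+n≡m (≤-trans (m∸n≤m ε E) (ε≤a fzero))) n+E≡S ⟩
      a + sum as                  ∎
      where
      regroup : ∀ n j E d → n + j + (E + d) ≡ (j + d) + (n + E)
      regroup = solve-∀

÷≡/ : ∀ m n .{{_ : NonZero n}} → m ÷ n ≡ m / n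
÷≡/ m (suc n) = refl

reduced-nonZero : ∀ r b .{{_ : NonZero r}} → NonZero (r ÷ gcd r b)
reduced-nonZero r b = subst NonZero (sym (÷≡/ r (gcd r b) {{g≢0}})) (≢-nonZero (m/gcd[m,n]≢0 r b {{gcd≢0 = g≢0}}))
  where
  g≢0 : NonZero (gcd r b)
  g≢0 = ≢-nonZero (gcd[m,n]≢0 r b (inj₁ (≢-nonZero⁻¹ r)))

module _ {p : ℕ} (p-prime : Prime p) where
  open Valuation p-prime

  -- Q = r / gcd r b and b / gcd r b are coprime, so p ∣ Q keeps p out of the cofactor of p ^ (K ∸ v p Q).
  reduced-order : ∀ {K} r b .{{_ : NonZero r}} → v p r ≤ K →
    v p (r ÷ gcd r b) ≤ v p r × HasOrderMod p K (v p (r ÷ gcd r b)) (p ^ (K ∸ v p r) * b)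
  reduced-order {K} r b a≤K = subst (λ ε → ε ≤ a × HasOrderMod p K ε (p ^ (K ∸ a) * b)) (sym (cong (v p) (÷≡/ r g)))
    (ε≤a , record { ε≤K = ≤-trans ε≤a a≤K ; cofactor = g′ * b′ ; factorisation = factorisation ; p∤cofactor = p∤cofactor })
    where
    open ≡-Reasoning
    g = gcd r b
    instance
      g≢0 : NonZero g
      g≢0 = ≢-nonZero (gcd[m,n]≢0 r b (inj₁ (≢-nonZero⁻¹ r)))
      Q≢0 : NonZero (r / g)
      Q≢0 = ≢-nonZero (m/gcd[m,n]≢0 r b)
    Q = r / g
    b′ = b / g
    a = v p r
    ε = v p Q
    γ = v p g
    a≡ε+γ : a ≡ ε + γ
    a≡ε+γ = trans (cong (v p) (sym (m/n*n≡m (gcd[m,n]∣m r b)))) (v-* Q g)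
    ε≤a : ε ≤ a
    ε≤a = subst (ε ≤_) (sym a≡ε+γ) (m≤m+n ε γ)
    g′ = proj₁ (v-cofactor g)
    K∸ε≡ : K ∸ ε ≡ K ∸ a + γ
    K∸ε≡ = begin
      K ∸ ε               ≡⟨ cong (_∸ ε) (m∸n+n≡m a≤K) ⟨
      K ∸ a + a ∸ ε       ≡⟨ +-∸-assoc (K ∸ a) ε≤a ⟩
      K ∸ a + (a ∸ ε)     ≡⟨ cong (λ x → K ∸ a + (x ∸ ε)) a≡ε+γ ⟩
      K ∸ a + (ε + γ ∸ ε) ≡⟨ cong (K ∸ a +_) (m+n∸m≡n ε γ) ⟩
      K ∸ a + γ           ∎
    factorisation : p ^ (K ∸ a) * b ≡ p ^ (K ∸ ε) * (g′ * b′)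
    factorisation = begin
      p ^ (K ∸ a) * b                      ≡⟨ cong (p ^ (K ∸ a) *_) (sym (m/n*n≡m (gcd[m,n]∣n r b))) ⟩
      p ^ (K ∸ a) * (b′ * g)               ≡⟨ cong (λ x → p ^ (K ∸ a) * (b′ * x)) (proj₁ (proj₂ (v-cofactor g))) ⟩
      p ^ (K ∸ a) * (b′ * (p ^ γ * g′))    ≡⟨ regroup (p ^ (K ∸ a)) b′ (p ^ γ) g′ ⟩
      p ^ (K ∸ a) * p ^ γ * (g′ * b′)      ≡⟨ cong (_* (g′ * b′)) (^-distribˡ-+-* p (K ∸ a) γ) ⟨
      p ^ (K ∸ a + γ) * (g′ * b′)          ≡⟨ cong (λ x → p ^ x * (g′ * b′)) K∸ε≡ ⟨
      p ^ (K ∸ ε) * (g′ * b′)              ∎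
      where
      regroup : ∀ P b′ G g′ → P * (b′ * (G * g′)) ≡ P * G * (g′ * b′)
      regroup = solve-∀
    p∤cofactor : 0 < ε → p ∤ g′ * b′
    p∤cofactor 0<ε p∣g′b′ with euclidsLemma g′ b′ p-prime p∣g′b′
    ... | inj₁ p∣g′ = proj₂ (proj₂ (v-cofactor g)) p∣g′
    ... | inj₂ p∣b′ = contradiction (coprime-/gcd r b (p∣Q , p∣b′)) (<⇒≢ (nonTrivial⇒n>1 p {{prime⇒nonTrivial p-prime}}) ∘ sym)
      where
      p∣Q : p ∣ Q
      p∣Q = ∣-trans (subst (_∣ p ^ ε) (*-identityʳ p) (^-monoʳ-∣ p 0<ε)) (proj₁ (v-spec Q))

  count-box-solutions : ∀ {k} K (r β : Vec ℕ k) → (∀ i → NonZero (lookup r i)) → (∀ i → v p (lookup r i) ≤ K) →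
    ∃[ n ] n + v p (e r β) ≡ v p (orderG r)
         × count (λ ω → p ^ K ∣? weightedSum (map (λ a → p ^ (K ∸ a)) (map (v p) r)) ω β)
                 (boxes (map (p ^_) (map (v p) r))) ≡ p ^ n
  count-box-solutions K r β r≢0 a≤K =
    let (n , n+E≡S , box-count) = BoxCount.count-box p-prime K (map (v p) r) cs β (map (v p) qs)
                                    (proj₁ ∘ coordinate) (proj₂ ∘ coordinate)
    in n , trans (cong (n +_) (v-foldr-lcm qs qs≢0)) (trans n+E≡S (sym (v-orderG r r≢0)))
         , DivIndicator.on-multiples box-count (_ ∣0)
    where
    qs = zipWith (λ rj βj → rj ÷ gcd rj βj) r β
    qs≢0 : ∀ i → NonZero (lookup qs i)
    qs≢0 i rewrite lookup-zipWith (λ rj βj → rj ÷ gcd rj βj) i r β = reduced-nonZero (lookup r i) (lookup β i) {{r≢0 i}}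
    cs = map (λ a → p ^ (K ∸ a)) (map (v p) r)
    coordinate : ∀ i → lookup (map (v p) qs) i ≤ lookup (map (v p) r) i
                     × HasOrderMod p K (lookup (map (v p) qs) i) (lookup cs i * lookup β i)
    coordinate i rewrite lookup-map i (v p) qs | lookup-zipWith (λ rj βj → rj ÷ gcd rj βj) i r β
                       | lookup-map i (λ a → p ^ (K ∸ a)) (map (v p) r) | lookup-map i (v p) r
      = reduced-order (lookup r i) (lookup β i) {{r≢0 i}} (a≤K i)

lookup⇒last : ∀ {m} {P : Pred X ℓ} (xs : Vec X (suc m)) → (∀ i → P (lookup xs i)) → P (last xs)
lookup⇒last (x ∷ []) P-all = P-all fzero
lookup⇒last {P = P} (x ∷ y ∷ xs) P-all = lookup⇒last {P = P} (y ∷ xs) (P-all ∘ fsuc)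

divisor-chain⇒∣last : ∀ {m} (r : Vec ℕ (suc m)) → (∀ (i : Fin m) → lookup r (inject₁ i) ∣ lookup r (fsuc i)) →
  ∀ i → lookup r i ∣ last r
divisor-chain⇒∣last (x ∷ []) _ fzero = ∣-refl
divisor-chain⇒∣last (x ∷ y ∷ r) chain fzero = ∣-trans (chain fzero) (divisor-chain⇒∣last (y ∷ r) (chain ∘ fsuc) fzero)
divisor-chain⇒∣last (x ∷ y ∷ r) chain (fsuc i) = divisor-chain⇒∣last (y ∷ r) (chain ∘ fsuc) i

lemma4p11 : (m : ℕ) (r β : Vec ℕ (suc m)) (p : ℕ) →
    (∀ i → 0 < lookup r i) →
    (∀ (i : Fin m) → lookup r (inject₁ i) ∣ lookup r (fsuc i)) →
    Prime p → p ∣ last r →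
    (∀ i → lookup β i < lookup r i) →
    length (A p r β) ≡ p ^ (v p (orderG r) ∸ v p (e r β))
lemma4p11 m r β p r>0 chain p-prime _ _ =
  let (n , n+vₑ≡v|G| , count≡pⁿ) = count-box-solutions p-prime (v p (last r)) r β r≢0 a≤vₙ in begin
  length (A p r β)                     ≡⟨ count≡pⁿ ⟩
  p ^ n                                ≡⟨ cong (p ^_) (trans (sym (m+n∸n≡m n (v p (e r β)))) (cong (_∸ v p (e r β)) n+vₑ≡v|G|)) ⟩
  p ^ (v p (orderG r) ∸ v p (e r β))   ∎
  where
  open ≡-Reasoning
  open Valuation p-prime
  r≢0 : ∀ i → NonZero (lookup r i)
  r≢0 i = >-nonZero (r>0 i)
  a≤vₙ : ∀ i → v p (lookup r i) ≤ v p (last r)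
  a≤vₙ i = v-mono-∣ {{r≢0 i}} {{lookup⇒last {P = NonZero} r r≢0}} (divisor-chain⇒∣last r chain i)
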